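{- Suppose $t_1\geq t_2\geq \cdots\geq t_k$ are positive integers with $\sum_{i=1}^k t_i = n$ and $\sum_{i=1}^k (t_i - 1) \leq \frac{n}{2} - 1$. Then there exist disjoint sets $A,B$ with $A\cup B = \{1, \ldots, k\}$ such that \[ \left| \sum_{i\in A} t_i - \sum_{j\in B} t_j \right| \leq 1. \] -}

module Defs where

open import Data.Nat using (ℕ; zero; suc; _+_)
open import Data.Fin using (Fin; zero; suc)
open import Data.Bool using (Bool; true; false; if_then_else_)

-- finite sum  ∑_{i < k} f i  (indices 0..k-1 stand for 1..k)
∑ : (k : ℕ) → (Fin k → ℕ) → ℕ
∑ zero    f = 0
∑ (suc k) f = f zero + ∑ k (λ i → f (suc i))

-- A partition {1..k} = A ⊔ B (disjoint, covering) is encoded by the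
-- indicator inA : Fin k → Bool, A = {i | inA i = true}, B = its complement.
sumA : (k : ℕ) → (Fin k → Bool) → (Fin k → ℕ) → ℕ
sumA k inA t = ∑ k (λ i → if inA i then t i else 0)

sumB : (k : ℕ) → (Fin k → Bool) → (Fin k → ℕ) → ℕ
sumB k inA t = ∑ k (λ i → if inA i then 0 else t i)

{-# OPTIONS --safe #-}
module Submission where

-- Greedy balancing along t₁ ≥ t₂ ≥ ⋯ ≥ t_k: keep the lead c of one side over the other and put
-- each item on the trailing side, so that the lead becomes |c - tᵢ| (the sides swap roles when
-- tᵢ > c).  With k items of total S still to place, the lead stays admissible, i.e.
-- c + S ≤ 2k + 1 and S < 2k when c = 0: an item lowers c + S by at least 2 unless it is placed
-- against a lead of 0, and a lead is cleared either by an item ≥ 2, which uses up 4 of the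
-- budget, or by a 1, after which only 1s remain.  Initially c = 0 and n < 2k by hypothesis;
-- at the end c ≤ 1.

open import Defs
open import Data.Nat using (ℕ; zero; suc; _+_; _*_; _∸_; _≤_; _<_; z≤n; s≤s; Ordering; less; equal; greater; compare)
open import Data.Nat.Properties
open import Data.Nat.Tactic.RingSolver using (solve-∀)
open import Data.Fin using (Fin; zero; suc) renaming (_≤_ to _≤ᶠ_)
open import Data.Bool using (Bool; false; not)
open import Data.Bool.Properties using (if-not)
open import Data.Vec.Functional using (_∷_)
open import Data.Product using (Σ; _×_; _,_; map)
open import Data.Sum using (_⊎_; inj₁; inj₂)
open import Function using (_∘_; id)
open import Relation.Binary.PropositionalEquality using (_≡_; refl; sym; trans; cong; cong₂; subst; subst₂; module ≡-Reasoning)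

∑-cong : ∀ k {f g : Fin k → ℕ} → (∀ i → f i ≡ g i) → ∑ k f ≡ ∑ k g
∑-cong zero    f≗g = refl
∑-cong (suc k) f≗g = cong₂ _+_ (f≗g zero) (∑-cong k (f≗g ∘ suc))

∑-≤-* : ∀ k {f : Fin k → ℕ} {b} → (∀ i → f i ≤ b) → ∑ k f ≤ k * b
∑-≤-* zero    f≤b = z≤n
∑-≤-* (suc k) f≤b = +-mono-≤ (f≤b zero) (∑-≤-* k (f≤b ∘ suc))

∑-∸-+-* : ∀ k {f : Fin k → ℕ} {b} → (∀ i → b ≤ f i) → ∑ k (λ i → f i ∸ b) + k * b ≡ ∑ k f
∑-∸-+-* zero    b≤f = refl
∑-∸-+-* (suc k) {f} {b} b≤f = begin
  (f zero ∸ b + ∑ k (λ i → f (suc i) ∸ b)) + (b + k * b)   ≡⟨ +-shuffle (f zero ∸ b) _ b _ ⟩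
  (f zero ∸ b + b) + (∑ k (λ i → f (suc i) ∸ b) + k * b)   ≡⟨ cong₂ _+_ (m∸n+n≡m (b≤f zero)) (∑-∸-+-* k (b≤f ∘ suc)) ⟩
  f zero + ∑ k (f ∘ suc)                                   ∎
  where
  open ≡-Reasoning
  +-shuffle : ∀ w x y z → (w + x) + (y + z) ≡ (w + y) + (x + z)
  +-shuffle = solve-∀

sumA-not : ∀ k (inA : Fin k → Bool) t → sumA k (not ∘ inA) t ≡ sumB k inA t
sumA-not k inA t = ∑-cong k (λ i → if-not (inA i))

sumB-not : ∀ k (inA : Fin k → Bool) t → sumB k (not ∘ inA) t ≡ sumA k inA t
sumB-not k inA t = ∑-cong k (λ i → if-not (inA i))

Near : ℕ → ℕ → Set
Near x y = x ≤ y + 1 × y ≤ x + 1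

Near-sym : ∀ {x y} → Near x y → Near y x
Near-sym (x≤y+1 , y≤x+1) = y≤x+1 , x≤y+1

Near-+ˡ : ∀ a {x y} → Near x y → Near (a + x) (a + y)
Near-+ˡ a {x} {y} (x≤y+1 , y≤x+1) = shift x≤y+1 , shift y≤x+1
  where
  shift : ∀ {u v} → u ≤ v + 1 → a + u ≤ a + v + 1
  shift {u} {v} u≤v+1 = subst (a + u ≤_) (sym (+-assoc a v 1)) (+-monoʳ-≤ a u≤v+1)

+-suc-assoc : ∀ a d x → a + (suc d + x) ≡ suc (a + d) + x
+-suc-assoc a d x = trans (sym (+-assoc a (suc d) x)) (cong (_+ x) (+-suc a d))

Admissible : ℕ → ℕ → ℕ → Set
Admissible k S c = c + S ≤ 2 * k + 1 × (c ≡ 0 → S < 2 * k ⊎ k ≡ 0)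

cancel-double : ∀ {a x} k → 0 < a → (a + a) + x ≤ 2 * suc k + 1 → x ≤ 2 * k + 1
cancel-double {a} {x} k 0<a a+a+x≤ = +-cancelˡ-≤ 2 x (2 * k + 1) (begin
  2 + x             ≤⟨ +-monoˡ-≤ x (+-mono-≤ 0<a 0<a) ⟩
  (a + a) + x       ≤⟨ a+a+x≤ ⟩
  2 * suc k + 1     ≡⟨ two-more k ⟩
  2 + (2 * k + 1)   ∎)
  where
  open ≤-Reasoning
  two-more : ∀ k → 2 * suc k + 1 ≡ 2 + (2 * k + 1)
  two-more = solve-∀

admissible-less : ∀ k {c d S} → Admissible (suc k) (suc (c + d) + S) c → Admissible k S (suc d)
admissible-less k {zero} {d} {S} (_ , c≡0⇒S<) with c≡0⇒S< refl
... | inj₂ ()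
... | inj₁ S<2k = ≤-pred (subst (suc d + S <_) (double-suc k) S<2k) , λ ()
  where
  double-suc : ∀ k → 2 * suc k ≡ suc (2 * k + 1)
  double-suc = solve-∀
admissible-less k {suc c} {d} {S} (c+S≤ , _) =
  cancel-double k (s≤s z≤n) (subst (_≤ 2 * suc k + 1) (regroup (suc c) d S) c+S≤) , λ ()
  where
  regroup : ∀ c d S → c + (suc (c + d) + S) ≡ (c + c) + (suc d + S)
  regroup = solve-∀

admissible-greater : ∀ k {t₀ d S} → 0 < t₀ → Admissible (suc k) (t₀ + S) (suc (t₀ + d)) → Admissible k S (suc d)
admissible-greater k {t₀} {d} {S} 0<t₀ (c+S≤ , _) =
  cancel-double k 0<t₀ (subst (_≤ 2 * suc k + 1) (regroup t₀ d S) c+S≤) , λ ()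
  where
  regroup : ∀ t₀ d S → suc (t₀ + d) + (t₀ + S) ≡ (t₀ + t₀) + (suc d + S)
  regroup = solve-∀

lead-cleared : ∀ k t₀ {S} → 0 < t₀ → S ≤ k * t₀ → t₀ + (t₀ + S) ≤ 2 * suc k + 1 → S < 2 * k ⊎ k ≡ 0
lead-cleared k       zero () _ _
lead-cleared zero    1 _ _ _ = inj₂ refl
lead-cleared (suc m) 1 {S} _ S≤k*1 _ =
  inj₁ (≤-<-trans (subst (S ≤_) (*-identityʳ (suc m)) S≤k*1) (m<m+n (suc m) (s≤s z≤n)))
lead-cleared k (suc (suc u)) {S} _ _ c+S≤ = inj₁ (≤-pred (subst (2 + S ≤_) (+-comm (2 * k) 1) 2+S≤2k+1))
  where
  regroup : ∀ u S → suc (suc u) + (suc (suc u) + S) ≡ (suc u + suc u) + (2 + S)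
  regroup = solve-∀
  2+S≤2k+1 : 2 + S ≤ 2 * k + 1
  2+S≤2k+1 = cancel-double k (s≤s z≤n) (subst (_≤ 2 * suc k + 1) (regroup u S) c+S≤)

admissible-equal : ∀ k {t₀ S} → 0 < t₀ → S ≤ k * t₀ → Admissible (suc k) (t₀ + S) t₀ → Admissible k S 0
admissible-equal k {t₀} {S} 0<t₀ S≤kt₀ (c+S≤ , _) =
  cancel-double k 0<t₀ (subst (_≤ 2 * suc k + 1) (sym (+-assoc t₀ t₀ S)) c+S≤) ,
  λ _ → lead-cleared k t₀ 0<t₀ S≤kt₀ c+S≤

greedy-balance : ∀ k (t : Fin k → ℕ) → (∀ i → 0 < t i) → (∀ i j → i ≤ᶠ j → t j ≤ t i)
  → ∀ c → Admissible k (∑ k t) c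
  → Σ (Fin k → Bool) λ inA → Near (c + sumA k inA t) (sumB k inA t)
greedy-balance zero    t _ _ c (c≤1 , _) = (λ ()) , c≤1 , z≤n
greedy-balance (suc k) t pos anti c adm =
  map (false ∷_) id (place (compare c (t zero)) (pos zero) (∑-≤-* k (λ i → anti zero (suc i) z≤n)) adm)
  where
  ts : Fin k → ℕ
  ts = t ∘ suc

  balance-tail : ∀ c → Admissible k (∑ k ts) c → Σ (Fin k → Bool) λ inA → Near (c + sumA k inA ts) (sumB k inA ts)
  balance-tail = greedy-balance k ts (pos ∘ suc) (λ i j i≤j → anti (suc i) (suc j) (s≤s i≤j))

  place : ∀ {c t₀} → Ordering c t₀ → 0 < t₀ → ∑ k ts ≤ k * t₀ → Admissible (suc k) (t₀ + ∑ k ts) c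
        → Σ (Fin k → Bool) λ inA → Near (c + sumA k inA ts) (t₀ + sumB k inA ts)
  place (less c d) _ _ adm = map (not ∘_) overtake (balance-tail (suc d) (admissible-less k adm))
    where
    overtake : ∀ {inA} → Near (suc d + sumA k inA ts) (sumB k inA ts)
             → Near (c + sumA k (not ∘ inA) ts) (suc (c + d) + sumB k (not ∘ inA) ts)
    overtake {inA} near =
      subst₂ (λ a b → Near (c + a) (suc (c + d) + b)) (sym (sumA-not k inA ts)) (sym (sumB-not k inA ts))
        (subst (Near (c + sumB k inA ts)) (+-suc-assoc c d _) (Near-+ˡ c (Near-sym near)))
  place (equal t₀) 0<t₀ S≤kt₀ adm = map id (Near-+ˡ t₀) (balance-tail 0 (admissible-equal k 0<t₀ S≤kt₀ adm))
  place (greater t₀ d) 0<t₀ _ adm = map id absorb (balance-tail (suc d) (admissible-greater k 0<t₀ adm))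
    where
    absorb : ∀ {x y} → Near (suc d + x) y → Near (suc (t₀ + d) + x) (t₀ + y)
    absorb {x} {y} near = subst (λ a → Near a (t₀ + y)) (+-suc-assoc t₀ d x) (Near-+ˡ t₀ near)

excess-bound : ∀ e k → 2 * e + 2 ≤ e + k → e + k < 2 * k
excess-bound e k 2e+2≤e+k = begin-strict
  e + k         <⟨ +-monoˡ-< k (m<m+n e (s≤s z≤n)) ⟩
  (e + 2) + k   ≤⟨ +-monoˡ-≤ k e+2≤k ⟩
  k + k         ≡⟨ cong (k +_) (sym (+-identityʳ k)) ⟩
  2 * k         ∎
  where
  open ≤-Reasoning
  regroup : ∀ e → 2 * e + 2 ≡ e + (e + 2)
  regroup = solve-∀
  e+2≤k : e + 2 ≤ k
  e+2≤k = +-cancelˡ-≤ e (e + 2) k (subst (_≤ e + k) (regroup e) 2e+2≤e+k)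

lemma2p2 : (k n : ℕ) (t : Fin k → ℕ)
    → (∀ i → 0 < t i)
    → (∀ i j → i ≤ᶠ j → t j ≤ t i)
    → ∑ k t ≡ n
    → 2 * ∑ k (λ i → t i ∸ 1) + 2 ≤ n
    → Σ (Fin k → Bool) (λ inA →
        (sumA k inA t ≤ sumB k inA t + 1) × (sumB k inA t ≤ sumA k inA t + 1))
lemma2p2 k n t pos anti refl 2e+2≤n =
  greedy-balance k t pos anti 0 (≤-trans (<⇒≤ n<2k) (m≤m+n _ 1) , λ _ → inj₁ n<2k)
  where
  e : ℕ
  e = ∑ k (λ i → t i ∸ 1)
  e+k≡n : e + k ≡ ∑ k t
  e+k≡n = trans (cong (e +_) (sym (*-identityʳ k))) (∑-∸-+-* k pos)
  n<2k : ∑ k t < 2 * k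
  n<2k = subst (_< 2 * k) e+k≡n (excess-bound e k (subst (2 * e + 2 ≤_) (sym e+k≡n) 2e+2≤n))
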